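{- If $T$ is a tree of order $n$, then there is a set $D$ of at most $\left\lceil\frac{n-2}{3}\right\rceil$ vertices of $T$ such that every vertex $u$ of $T$ that has degree at least $2$ and does not belong to $D$ has a neighbor in $D$.
   Context: Graphs are finite, simple and undirected; a tree is a connected acyclic graph. -}

module Defs where

open import Data.Nat using (ℕ; suc; _≤_; _∸_; _+_)
open import Data.Nat.DivMod using (_/_)
open import Data.Fin using (Fin)
open import Data.Bool using (Bool; true; false; T)
open import Data.List using (List; []; _∷_; length; filter; allFin)
open import Data.List.Relation.Unary.Unique.Propositional using (Unique)
open import Data.Product using (Σ; ∃; _×_; ∃-syntax)
open import Relation.Binary.PropositionalEquality using (_≡_)
open import Relation.Nullary using (¬_)
open import Relation.Nullary.Decidable using (T?)

record Graph (n : ℕ) : Set where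
  field
    adj   : Fin n → Fin n → Bool
    sym   : ∀ u v → adj u v ≡ adj v u
    irrefl : ∀ v → adj v v ≡ false

module _ {n : ℕ} (G : Graph n) where
  open Graph G

  Adj : Fin n → Fin n → Set
  Adj u v = T (adj u v)

  degree : Fin n → ℕ
  degree v = length (filter (λ u → T? (adj v u)) (allFin n))

  data Walk : Fin n → Fin n → Set where
    [] : ∀ {u} → Walk u u
    _∷_ : ∀ {u v w} → Adj u v → Walk v w → Walk u w

  Connected : Set
  Connected = ∀ u v → Walk u v

  Chain : Fin n → List (Fin n) → Fin n → Set
  Chain x [] y = x ≡ y
  Chain x (z ∷ zs) y = Adj x z × Chain z zs y

  HasCycle : Set
  HasCycle = ∃[ v₀ ] ∃[ rest ] ∃[ vₖ ]
             (2 ≤ length rest) × Unique (v₀ ∷ rest) × Chain v₀ rest vₖ × Adj vₖ v₀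

  IsTree : Set
  IsTree = Connected × ¬ HasCycle

-- ⌈ (n - 2) / 3 ⌉, with n - 2 truncated at 0 (for n < 2 the true value is 0 anyway)
ceil[n-2]/3 : ℕ → ℕ
ceil[n-2]/3 n = (n ∸ 2 + 2) / 3

module Submission where

open import Defs
open import Data.Nat using (ℕ; _≤_)
open import Data.Fin using (Fin)
open import Data.Fin.Subset using (Subset; _∈_; _∉_; ∣_∣)
open import Data.Product using (∃-syntax; _×_)

-- Root the tree T at a vertex r of degree at most 1 and split the vertices
-- into three layers by their depth modulo 3.  The layers partition the n vertices, so one
-- has at most ⌊n/3⌋ = ⌈(n-2)/3⌉ elements; take it as D.  A vertex u of degree ≥ 2 is not
-- the root, so it has a parent and a child; the depths of parent, u and child cover all
-- residues modulo 3, so one of the three lies in D.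
--
-- Formally the rooted tree is the unfolding of T from r into a rose tree, cut off at depth
-- n.  Acyclicity is used only via: non-backtracking walks never repeat a vertex.  It gives
-- a vertex of degree ≤ 1 (a maximal non-backtracking walk ends in one) and shows that the
-- unfolding lists each vertex once, so its layers have at most n elements in total.
-- Connectivity makes every vertex the end of a non-backtracking walk from r, hence a node
-- of the unfolding with its parent and, if its degree is ≥ 2, a child.

open import Data.Nat using (zero; suc; _*_; _+_; _∸_; z≤n; s≤s; s≤s⁻¹; _<_)
open import Data.Nat.Properties
  using (≤-refl; ≤-trans; ≤-reflexive; ≤-total; +-mono-≤; +-monoʳ-≤; +-suc; +-comm; +-identityʳ; *-comm;
         m≤n+m∸n; <⇒≱; _≤?_; ≰⇒>; module ≤-Reasoning)
open import Data.Nat.DivMod using (_/_; m*n/n≡m; /-monoˡ-≤)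
open import Data.Nat.Solver using (module +-*-Solver)
open import Data.Fin as Fin using (_≟_)
open import Data.Fin.Properties using (pigeonhole; <⇒≢)
open import Data.Fin.Subset using (⁅_⁆; _∪_) renaming (⊥ to ∅)
open import Data.Fin.Subset.Properties using (x∈p∪q⁺; x∈⁅x⁆; ∣⊥∣≡0; ∣⁅x⁆∣≡1; ∣p∣≤∣x∷p∣)
import Data.Vec as Vec
open import Data.Bool using (true; false; T)
open import Data.List using (List; []; _∷_; _++_; length; filter; allFin; lookup; map; reverse)
open import Data.List.Properties using (length-++; ++-assoc; ʳ++-defn)
open import Data.List.Membership.Propositional using () renaming (_∈_ to _∈ₗ_)
open import Data.List.Membership.Propositional.Properties
  using (∈-++⁻; ∈-++⁺ˡ; ∈-++⁺ʳ; ∈-filter⁺; ∈-filter⁻; ∈-allFin; ∈-lookup; ∈-∃++; ∈-map⁺; ∈-map⁻)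
open import Data.List.Relation.Binary.Subset.Propositional using () renaming (_⊆_ to _⊆ₗ_)
open import Data.List.Relation.Unary.Any using (here; there)
open import Data.List.Relation.Unary.Any.Properties using (reverse⁺)
open import Data.List.Relation.Unary.All as All using ([]; _∷_)
open import Data.List.Relation.Unary.All.Properties using (¬Any⇒All¬; ++⁻ˡ)
open import Data.List.Relation.Unary.AllPairs using ([]; _∷_)
open import Data.List.Relation.Unary.Unique.Propositional using (Unique)
import Data.List.Relation.Unary.Unique.Propositional.Properties as Unique
open import Data.Product using (_,_; proj₁; proj₂)
open import Data.Sum using (_⊎_; inj₁; inj₂)
open import Data.Unit using (tt) renaming (⊤ to Unit)
open import Data.Empty using (⊥; ⊥-elim)
open import Relation.Nullary using (¬_; yes; no; ¬?)
open import Relation.Nullary.Decidable using (T?; _×-dec_)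
open import Relation.Binary.Definitions using (DecidableEquality)
open import Relation.Binary.PropositionalEquality using (_≡_; _≢_; refl; sym; trans; cong; cong₂; subst; module ≡-Reasoning)

-- Lists without repetitions

module _ {A : Set} where

  unique-disjoint : ∀ xs {ys : List A} {x} → Unique (xs ++ ys) → x ∈ₗ xs → x ∈ₗ ys → ⊥
  unique-disjoint (a ∷ xs) (a∉ ∷ _) (here refl) x∈ys = All.lookup a∉ (∈-++⁺ʳ xs x∈ys) refl
  unique-disjoint (a ∷ xs) (_ ∷ u) (there x∈xs) x∈ys = unique-disjoint xs u x∈xs x∈ys

  unique-prefix : ∀ xs {ys : List A} → Unique (xs ++ ys) → Unique xs
  unique-prefix [] _ = []
  unique-prefix (x ∷ xs) (x∉ ∷ u) = ++⁻ˡ xs x∉ ∷ unique-prefix xs u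

  other-than : DecidableEquality A → ∀ {xs : List A} → Unique xs → 2 ≤ length xs →
               ∀ p → ∃[ x ] (x ∈ₗ xs × p ≢ x)
  other-than _ {[]} _ () _
  other-than _ {_ ∷ []} _ (s≤s ()) _
  other-than _≟ₐ_ {a ∷ b ∷ _} ((a≢b ∷ _) ∷ _) _ p with p ≟ₐ a
  ... | yes refl = b , there (here refl) , a≢b
  ... | no p≢a = a , here refl , p≢a

unique-length : ∀ {n} {xs : List (Fin n)} → Unique xs → length xs ≤ n
unique-length {n} {xs} u with length xs ≤? n
... | yes fits = fits
... | no overflow with pigeonhole (≰⇒> overflow) (lookup xs)
... | i , j , i<j , same = ⊥-elim (<⇒≢ i<j (lookup-injective u i j same))
  where
  lookup-injective : ∀ {ys : List (Fin n)} → Unique ys → ∀ i j → lookup ys i ≡ lookup ys j → i ≡ j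
  lookup-injective (_ ∷ _) Fin.zero Fin.zero _ = refl
  lookup-injective (y∉ ∷ _) Fin.zero (Fin.suc j) eq = ⊥-elim (All.lookup y∉ (∈-lookup j) eq)
  lookup-injective (y∉ ∷ _) (Fin.suc i) Fin.zero eq = ⊥-elim (All.lookup y∉ (∈-lookup i) (sym eq))
  lookup-injective (_ ∷ u) (Fin.suc i) (Fin.suc j) eq = cong Fin.suc (lookup-injective u i j eq)

open +-*-Solver using (solve; _:+_; _:*_; con; _:=_)

thrice-below : ∀ {x a b c} → x ≤ a → x ≤ b → x ≤ c → 3 * x ≤ a + b + c
thrice-below {x} {a} {b} {c} x≤a x≤b x≤c = begin
  3 * x      ≡⟨ solve 1 (λ x → con 3 :* x := x :+ x :+ x) refl x ⟩
  x + x + x  ≤⟨ +-mono-≤ (+-mono-≤ x≤a x≤b) x≤c ⟩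
  a + b + c  ∎
  where open ≤-Reasoning

third-of-sum : ∀ a b c → 3 * a ≤ a + b + c ⊎ 3 * b ≤ a + b + c ⊎ 3 * c ≤ a + b + c
third-of-sum a b c with ≤-total a b
... | inj₁ a≤b with ≤-total a c
...   | inj₁ a≤c = inj₁ (thrice-below ≤-refl a≤b a≤c)
...   | inj₂ c≤a = inj₂ (inj₂ (thrice-below c≤a (≤-trans c≤a a≤b) ≤-refl))
third-of-sum a b c | inj₂ b≤a with ≤-total b c
...   | inj₁ b≤c = inj₂ (inj₁ (thrice-below b≤a ≤-refl b≤c))
...   | inj₂ c≤b = inj₂ (inj₂ (thrice-below (≤-trans c≤b b≤a) c≤b ≤-refl))

-- For n ≥ 2, ⌈(n-2)/3⌉ = ⌊n/3⌋; in any case a number at most n/3 is at most ⌈(n-2)/3⌉.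
below-ceil : ∀ L n → 3 * L ≤ n → L ≤ ceil[n-2]/3 n
below-ceil L n 3L≤n = begin
  L                ≡⟨ sym (m*n/n≡m L 3) ⟩
  L * 3 / 3        ≤⟨ /-monoˡ-≤ 3 (≤-trans (≤-reflexive (*-comm L 3)) 3L≤n) ⟩
  n / 3            ≤⟨ /-monoˡ-≤ 3 (≤-trans (m≤n+m∸n n 2) (≤-reflexive (+-comm 2 (n ∸ 2)))) ⟩
  (n ∸ 2 + 2) / 3  ∎
  where open ≤-Reasoning

entries : ∀ {n} → List (Fin n) → Subset n
entries [] = ∅
entries (x ∷ xs) = ⁅ x ⁆ ∪ entries xs

entries-mem : ∀ {n} {x : Fin n} {xs} → x ∈ₗ xs → x ∈ entries xs
entries-mem {x = x} (here refl) = x∈p∪q⁺ (inj₁ (x∈⁅x⁆ x))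
entries-mem (there x∈xs) = x∈p∪q⁺ (inj₂ (entries-mem x∈xs))

∣p∪q∣≤∣p∣+∣q∣ : ∀ {n} (p q : Subset n) → ∣ p ∪ q ∣ ≤ ∣ p ∣ + ∣ q ∣
∣p∪q∣≤∣p∣+∣q∣ Vec.[] Vec.[] = z≤n
∣p∪q∣≤∣p∣+∣q∣ (true Vec.∷ p) (y Vec.∷ q) = s≤s (≤-trans (∣p∪q∣≤∣p∣+∣q∣ p q) (+-monoʳ-≤ ∣ p ∣ (∣p∣≤∣x∷p∣ y q)))
∣p∪q∣≤∣p∣+∣q∣ (false Vec.∷ p) (true Vec.∷ q) = ≤-trans (s≤s (∣p∪q∣≤∣p∣+∣q∣ p q)) (≤-reflexive (sym (+-suc ∣ p ∣ ∣ q ∣)))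
∣p∪q∣≤∣p∣+∣q∣ (false Vec.∷ p) (false Vec.∷ q) = ∣p∪q∣≤∣p∣+∣q∣ p q

∣entries∣≤length : ∀ {n} (xs : List (Fin n)) → ∣ entries xs ∣ ≤ length xs
∣entries∣≤length {n} [] = ≤-reflexive (∣⊥∣≡0 n)
∣entries∣≤length (x ∷ xs) = begin
  ∣ ⁅ x ⁆ ∪ entries xs ∣          ≤⟨ ∣p∪q∣≤∣p∣+∣q∣ ⁅ x ⁆ (entries xs) ⟩
  ∣ ⁅ x ⁆ ∣ + ∣ entries xs ∣      ≡⟨ cong (_+ ∣ entries xs ∣) (∣⁅x⁆∣≡1 x) ⟩
  suc ∣ entries xs ∣              ≤⟨ s≤s (∣entries∣≤length xs) ⟩
  length (x ∷ xs)                 ∎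
  where open ≤-Reasoning

-- Rooted trees and their depth layers modulo 3

data Rose (A : Set) : Set where
  node : A → List (Rose A) → Rose A

-- The residue modulo 3 of the depth of a node.
data Residue : Set where
  r₀ r₁ r₂ : Residue

-- Depth residue, seen from a child subtree, of a node with depth residue i.
pred₃ : Residue → Residue
pred₃ r₀ = r₂
pred₃ r₁ = r₀
pred₃ r₂ = r₁

module _ {A : Set} where

  root : Rose A → A
  root (node v _) = v

  mutual
    flat : Rose A → List A
    flat (node v ks) = v ∷ flats ks

    flats : List (Rose A) → List A
    flats [] = []
    flats (k ∷ ks) = flat k ++ flats ks

  size : Rose A → ℕ
  size R = length (flat R)

  flats-mem : ∀ {x} ks → x ∈ₗ flats ks → ∃[ k ] (k ∈ₗ ks × x ∈ₗ flat k)
  flats-mem (k ∷ ks) x∈ with ∈-++⁻ (flat k) x∈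
  ... | inj₁ x∈k = k , here refl , x∈k
  ... | inj₂ x∈ks with flats-mem ks x∈ks
  ... | k' , k'∈ , x∈k' = k' , there k'∈ , x∈k'

  data _⊑_ : Rose A → Rose A → Set where
    ⊑-refl : ∀ {R} → R ⊑ R
    ⊑-child : ∀ {X v k ks} → k ∈ₗ ks → X ⊑ k → X ⊑ node v ks

  -- layer i R: the labels of the nodes of R whose depth is congruent to i modulo 3.
  mutual
    layer : Residue → Rose A → List A
    layer r₀ (node v ks) = v ∷ layers r₂ ks
    layer r₁ (node v ks) = layers r₀ ks
    layer r₂ (node v ks) = layers r₁ ks

    layers : Residue → List (Rose A) → List A
    layers i [] = []
    layers i (k ∷ ks) = layer i k ++ layers i ks

  layers-⊇ : ∀ i {k ks} → k ∈ₗ ks → layer i k ⊆ₗ layers i ks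
  layers-⊇ i {ks = k ∷ _} (here refl) x∈ = ∈-++⁺ˡ x∈
  layers-⊇ i {ks = k ∷ _} (there k∈) x∈ = ∈-++⁺ʳ (layer i k) (layers-⊇ i k∈ x∈)

  layer-child : ∀ i {v k ks} → k ∈ₗ ks → layer (pred₃ i) k ⊆ₗ layer i (node v ks)
  layer-child r₀ k∈ x∈ = there (layers-⊇ r₂ k∈ x∈)
  layer-child r₁ k∈ x∈ = layers-⊇ r₀ k∈ x∈
  layer-child r₂ k∈ x∈ = layers-⊇ r₁ k∈ x∈

  layer-subtree : ∀ {X R} → X ⊑ R → ∀ i → ∃[ j ] (layer j X ⊆ₗ layer i R)
  layer-subtree ⊑-refl i = i , λ x∈ → x∈
  layer-subtree (⊑-child k∈ X⊑k) i with layer-subtree X⊑k (pred₃ i)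
  ... | j , incl = j , λ x∈ → layer-child i k∈ (incl x∈)

  three-generations : ∀ i {v ks u js} {Y : Rose A} → node u js ∈ₗ ks → Y ∈ₗ js →
    let L = layer i (node v ks) in v ∈ₗ L ⊎ u ∈ₗ L ⊎ root Y ∈ₗ L
  three-generations r₀ _ _ = inj₁ (here refl)
  three-generations r₁ {v} X∈ _ = inj₂ (inj₁ (layer-child r₁ {v} X∈ (here refl)))
  three-generations r₂ {v} {u = u} {Y = node y _} X∈ Y∈ =
    inj₂ (inj₂ (layer-child r₂ {v} X∈ (layer-child r₁ {u} Y∈ (here refl))))

  mutual
    layer-sizes : ∀ R → length (layer r₀ R) + length (layer r₁ R) + length (layer r₂ R) ≡ size R
    layer-sizes (node v ks) = cong suc (begin
      a₂ + a₀ + a₁   ≡⟨ solve 3 (λ a₀ a₁ a₂ → a₂ :+ a₀ :+ a₁ := a₀ :+ a₁ :+ a₂) refl a₀ a₁ a₂ ⟩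
      a₀ + a₁ + a₂   ≡⟨ layers-sizes ks ⟩
      length (flats ks) ∎)
      where
      open ≡-Reasoning
      a₀ a₁ a₂ : ℕ
      a₀ = length (layers r₀ ks)
      a₁ = length (layers r₁ ks)
      a₂ = length (layers r₂ ks)

    layers-sizes : ∀ ks → length (layers r₀ ks) + length (layers r₁ ks) + length (layers r₂ ks) ≡ length (flats ks)
    layers-sizes [] = refl
    layers-sizes (k ∷ ks) = begin
      length (layer r₀ k ++ layers r₀ ks) + length (layer r₁ k ++ layers r₁ ks)
        + length (layer r₂ k ++ layers r₂ ks)
        ≡⟨ cong₂ _+_ (cong₂ _+_ (length-++ (layer r₀ k) {layers r₀ ks}) (length-++ (layer r₁ k) {layers r₁ ks}))
                     (length-++ (layer r₂ k) {layers r₂ ks}) ⟩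
      (b₀ + a₀) + (b₁ + a₁) + (b₂ + a₂)
        ≡⟨ solve 6 (λ a₀ a₁ a₂ b₀ b₁ b₂ → (b₀ :+ a₀) :+ (b₁ :+ a₁) :+ (b₂ :+ a₂)
                                          := (b₀ :+ b₁ :+ b₂) :+ (a₀ :+ a₁ :+ a₂)) refl a₀ a₁ a₂ b₀ b₁ b₂ ⟩
      (b₀ + b₁ + b₂) + (a₀ + a₁ + a₂)
        ≡⟨ cong₂ _+_ (layer-sizes k) (layers-sizes ks) ⟩
      size k + length (flats ks)
        ≡⟨ sym (length-++ (flat k)) ⟩
      length (flat k ++ flats ks) ∎
      where
      open ≡-Reasoning
      a₀ a₁ a₂ b₀ b₁ b₂ : ℕ
      a₀ = length (layers r₀ ks)
      a₁ = length (layers r₁ ks)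
      a₂ = length (layers r₂ ks)
      b₀ = length (layer r₀ k)
      b₁ = length (layer r₁ k)
      b₂ = length (layer r₂ k)

  thin-layer : ∀ R → ∃[ i ] (3 * length (layer i R) ≤ size R)
  thin-layer R with third-of-sum (length (layer r₀ R)) (length (layer r₁ R)) (length (layer r₂ R))
  ... | inj₁ small = r₀ , ≤-trans small (≤-reflexive (layer-sizes R))
  ... | inj₂ (inj₁ small) = r₁ , ≤-trans small (≤-reflexive (layer-sizes R))
  ... | inj₂ (inj₂ small) = r₂ , ≤-trans small (≤-reflexive (layer-sizes R))

-- Non-backtracking walks and the unfolding of a graph

module Unfolding {n : ℕ} (G : Graph n) where

  open Graph G using (adj)

  V : Set
  V = Fin n

  _~_ : V → V → Set
  _~_ = Adj G

  ~-sym : ∀ {u v} → u ~ v → v ~ u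
  ~-sym {u} {v} = subst T (Graph.sym G u v)

  ~-irrefl : ∀ {v} → v ~ v → ⊥
  ~-irrefl {v} = subst T (Graph.irrefl G v)

  ~⇒≢ : ∀ {u v} → u ~ v → u ≢ v
  ~⇒≢ u~v refl = ~-irrefl u~v

  NotFirst : V → List V → Set
  NotFirst x [] = Unit
  NotFirst x (y ∷ _) = x ≢ y

  data NB : List V → Set where
    single : ∀ {x} → NB (x ∷ [])
    step : ∀ {x y ys} → x ~ y → NotFirst x ys → NB (y ∷ ys) → NB (x ∷ y ∷ ys)

  lastOf : V → List V → V
  lastOf v [] = v
  lastOf v (w ∷ q) = lastOf w q

  lastOf∈ : ∀ w q → lastOf w q ∈ₗ (w ∷ q)
  lastOf∈ w [] = here refl
  lastOf∈ w (x ∷ q) = there (lastOf∈ x q)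

  glue : ∀ xs {a b} ys → NB (xs ++ a ∷ b ∷ []) → NB (a ∷ b ∷ ys) → NB (xs ++ a ∷ b ∷ ys)
  glue [] ys _ q = q
  glue (x ∷ []) ys (step x~a x≢b _) q = step x~a x≢b q
  glue (x ∷ y ∷ []) ys (step x~y x≢a p) q = step x~y x≢a (glue (y ∷ []) ys p q)
  glue (x ∷ y ∷ z ∷ xs) ys (step x~y x≢z p) q = step x~y x≢z (glue (y ∷ z ∷ xs) ys p q)

  nb-reverse : ∀ {xs} → NB xs → NB (reverse xs)
  nb-reverse single = single
  nb-reverse (step x~y _ single) = step (~-sym x~y) tt single
  nb-reverse {x ∷ y ∷ z ∷ r} (step x~y x≢z rest@(step y~z _ _)) =
    subst NB (sym (ʳ++-defn r))
      (glue (reverse r) (x ∷ []) (subst NB (ʳ++-defn r) (nb-reverse rest)) turn)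
    where
    turn : NB (z ∷ y ∷ x ∷ [])
    turn = step (~-sym y~z) (λ z≡x → x≢z (sym z≡x)) (step (~-sym x~y) tt single)

  shortcut : ∀ {a b} → Walk G a b → ∃[ q ] (NB (a ∷ q) × lastOf a q ≡ b)
  shortcut [] = [] , single , refl
  shortcut (_∷_ {a} {c} a~c w) with shortcut w
  ... | [] , _ , end = c ∷ [] , step a~c tt single , end
  ... | z ∷ q , p@(step _ _ rest) , end with z ≟ a
  ...   | yes refl = q , rest , end
  ...   | no z≢a = c ∷ z ∷ q , step a~c (λ a≡z → z≢a (sym a≡z)) p , end

  nb-chain : ∀ x ys {y zs} → NB (x ∷ ys ++ y ∷ zs) → Chain G x ys (lastOf x ys) × lastOf x ys ~ y
  nb-chain x [] (step x~y _ _) = refl , x~y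
  nb-chain x (y ∷ ys) (step x~y _ rest) with nb-chain y ys rest
  ... | chain , closing = (x~y , chain) , closing

  -- kids p v : the neighbours of v other than p (the children of v when coming from p).
  kids : V → V → List V
  kids p v = filter (λ w → T? (adj v w) ×-dec ¬? (p ≟ w)) (allFin n)

  kids-mem : ∀ {p v w} → w ∈ₗ kids p v → v ~ w × p ≢ w
  kids-mem {p} {v} w∈ = proj₂ (∈-filter⁻ (λ w → T? (adj v w) ×-dec ¬? (p ≟ w)) {xs = allFin n} w∈)

  kids-in : ∀ {p v w} → v ~ w → p ≢ w → w ∈ₗ kids p v
  kids-in {p} {v} {w} v~w p≢w = ∈-filter⁺ (λ w → T? (adj v w) ×-dec ¬? (p ≟ w)) (∈-allFin w) (v~w , p≢w)

  kids-unique : ∀ p v → Unique (kids p v)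
  kids-unique p v = Unique.filter⁺ (λ w → T? (adj v w) ×-dec ¬? (p ≟ w)) (Unique.allFin⁺ n)

  kid-exists : ∀ p u → 2 ≤ degree G u → ∃[ w ] (w ∈ₗ kids p u)
  kid-exists p u deg with other-than _≟_ (Unique.filter⁺ (λ w → T? (adj u w)) (Unique.allFin⁺ n)) deg p
  ... | w , w∈ , p≢w = w , kids-in (proj₂ (∈-filter⁻ (λ w → T? (adj u w)) {xs = allFin n} w∈)) p≢w

  -- unfold f p v : the tree of non-backtracking walks from v not starting towards p,
  -- cut off at depth f.
  unfold : ℕ → V → V → Rose V
  unfold zero p v = node v []
  unfold (suc f) p v = node v (map (unfold f v) (kids p v))

  root-unfold : ∀ f p v → root (unfold f p v) ≡ v
  root-unfold zero p v = refl
  root-unfold (suc f) p v = refl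

  child-unfold : ∀ {f p v w} → w ∈ₗ kids p v → unfold f v w ∈ₗ map (unfold f v) (kids p v)
  child-unfold {f} {v = v} = ∈-map⁺ (unfold f v)

  path-to : ∀ f p v {u} → u ∈ₗ flat (unfold f p v) → ∃[ q ] (NB (v ∷ q) × lastOf v q ≡ u × NotFirst p q)
  path-to zero p v (here refl) = [] , single , refl , tt
  path-to (suc f) p v (here refl) = [] , single , refl , tt
  path-to (suc f) p v (there u∈) with flats-mem (map (unfold f v) (kids p v)) u∈
  ... | k , k∈ , u∈k with ∈-map⁻ (unfold f v) k∈
  ... | w , w∈ , refl with path-to f v w u∈k | kids-mem w∈
  ... | q , walk , end , v≢q₀ | v~w , p≢w = w ∷ q , step v~w v≢q₀ walk , end , p≢w

  -- The end u of a non-backtracking walk v w … u of length at most f+1 not starting towards p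
  -- appears in unfold (f+1) p v as a child of some node, and with room for a child of its own.
  parent-node : ∀ f p v w q → NB (v ∷ w ∷ q) → p ≢ w → length q < f →
    ∃[ g ] ∃[ p' ] ∃[ f' ] (unfold (suc (suc f')) g p' ⊑ unfold (suc f) p v × lastOf w q ∈ₗ kids g p')
  parent-node (suc f') p v w [] (step v~w _ _) p≢w _ = p , v , f' , ⊑-refl , kids-in v~w p≢w
  parent-node (suc f) p v w (w' ∷ q) (step v~w v≢w' walk) p≢w (s≤s short)
    with parent-node f v w w' q walk v≢w' short
  ... | g , p' , f' , sub , u∈ = g , p' , f' , ⊑-child (child-unfold {suc f} (kids-in v~w p≢w)) sub , u∈

  layer-dominates : ∀ i f p v w q → NB (v ∷ w ∷ q) → p ≢ w → length q < f → 2 ≤ degree G (lastOf w q) →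
    ∃[ x ] (x ∈ₗ layer i (unfold (suc f) p v) × (x ≡ lastOf w q ⊎ lastOf w q ~ x))
  layer-dominates i f p v w q walk p≢w short deg with parent-node f p v w q walk p≢w short
  ... | g , p' , f' , sub , u∈ with layer-subtree sub i | kid-exists p' (lastOf w q) deg
  ... | j , incl | c , c∈ with three-generations j (child-unfold {suc f'} u∈) (child-unfold {f'} c∈)
  ... | inj₁ p'∈ = p' , incl p'∈ , inj₂ (~-sym (proj₁ (kids-mem u∈)))
  ... | inj₂ (inj₁ u∈L) = lastOf w q , incl u∈L , inj₁ refl
  ... | inj₂ (inj₂ c∈L) = c , incl (subst (_∈ₗ _) (root-unfold f' (lastOf w q) c) c∈L) , inj₂ (proj₁ (kids-mem c∈))

  module Acyclic (acyclic : ¬ HasCycle G) where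

    no-return : ∀ x ys zs → NB (x ∷ ys ++ x ∷ zs) → Unique (ys ++ x ∷ zs) → ⊥
    no-return x [] zs (step x~x _ _) _ = ~-irrefl x~x
    no-return x (y ∷ []) zs (step _ x≢x _) _ = x≢x refl
    no-return x ys@(_ ∷ _ ∷ _) zs walk u =
      acyclic (x , ys , lastOf x ys , s≤s (s≤s z≤n) , simple , proj₁ closed , proj₂ closed)
      where
      simple : Unique (x ∷ ys)
      simple = ¬Any⇒All¬ ys (λ x∈ys → unique-disjoint ys u x∈ys (here refl)) ∷ unique-prefix ys u
      closed : Chain G x ys (lastOf x ys) × lastOf x ys ~ x
      closed = nb-chain x ys walk

    nb-unique : ∀ {xs} → NB xs → Unique xs
    nb-unique single = [] ∷ []
    nb-unique {x ∷ xs} walk@(step _ _ rest) = ¬Any⇒All¬ xs x∉ ∷ nb-unique rest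
      where
      x∉ : x ∈ₗ xs → ⊥
      x∉ x∈xs with ∈-∃++ x∈xs
      ... | ys , zs , split =
        no-return x ys zs (subst (λ l → NB (x ∷ l)) split walk) (subst Unique split (nb-unique rest))

    path-unique : ∀ {v w w'} q q' → NB (v ∷ w ∷ q) → NB (v ∷ w' ∷ q') →
                  lastOf w q ≡ lastOf w' q' → w ≡ w'
    path-unique {v} {w} {w'} q q' p@(step v~w _ _) p' same with w ≟ w'
    ... | yes w≡w' = w≡w'
    ... | no w≢w' = ⊥-elim (unique-disjoint (reverse q ++ w ∷ []) simple x∈back x∈forth)
      where
      back : NB (reverse q ++ w ∷ v ∷ [])
      back = subst NB (ʳ++-defn q) (nb-reverse p)
      there-and-back : NB (reverse q ++ w ∷ v ∷ w' ∷ q')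
      there-and-back = glue (reverse q) (w' ∷ q') back (step (~-sym v~w) w≢w' p')
      simple : Unique ((reverse q ++ w ∷ []) ++ v ∷ w' ∷ q')
      simple = subst Unique (sym (++-assoc (reverse q) (w ∷ []) (v ∷ w' ∷ q'))) (nb-unique there-and-back)
      x∈back : lastOf w q ∈ₗ reverse q ++ w ∷ []
      x∈back = subst (lastOf w q ∈ₗ_) (ʳ++-defn q) (reverse⁺ (lastOf∈ w q))
      x∈forth : lastOf w q ∈ₗ v ∷ w' ∷ q'
      x∈forth = subst (_∈ₗ v ∷ w' ∷ q') (sym same) (there (lastOf∈ w' q'))

    mutual
      unique-flat : ∀ f p v → Unique (flat (unfold f p v))
      unique-flat zero p v = [] ∷ []
      unique-flat (suc f) p v =
        ¬Any⇒All¬ _ v∉ ∷ unique-flats f v (kids p v) (kids-unique p v) (λ w∈ → proj₁ (kids-mem w∈))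
        where
        -- a walk v w … v would return to its start
        v∉ : v ∈ₗ flats (map (unfold f v) (kids p v)) → ⊥
        v∉ v∈ with flats-mem (map (unfold f v) (kids p v)) v∈
        ... | k , k∈ , v∈k with ∈-map⁻ (unfold f v) k∈
        ... | w , w∈ , refl with path-to f v w v∈k
        ... | q , walk , end , v≢q₀ with nb-unique (step (proj₁ (kids-mem w∈)) v≢q₀ walk)
        ... | v∉wq ∷ _ = All.lookup v∉wq (lastOf∈ w q) (sym end)

      -- subtrees of distinct children are disjoint, as both are reached from v by
      -- non-backtracking walks
      unique-flats : ∀ f v ws → Unique ws → (∀ {w} → w ∈ₗ ws → v ~ w) →
                     Unique (flats (map (unfold f v) ws))
      unique-flats f v [] _ _ = []
      unique-flats f v (w ∷ ws) (w∉ ∷ u) v~ =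
        Unique.++⁺ (unique-flat f v w) (unique-flats f v ws u (λ w∈ → v~ (there w∈))) disjoint
        where
        disjoint : ∀ {x} → ¬ (x ∈ₗ flat (unfold f v w) × x ∈ₗ flats (map (unfold f v) ws))
        disjoint (x∈ , x∈ws) with flats-mem (map (unfold f v) ws) x∈ws
        ... | k , k∈ , x∈k with ∈-map⁻ (unfold f v) k∈
        ... | w' , w'∈ , refl with path-to f v w x∈ | path-to f v w' x∈k
        ... | q , walk , end , v≢q₀ | q' , walk' , end' , v≢q₀' =
          All.lookup w∉ w'∈ (path-unique q q' (step (v~ (here refl)) v≢q₀ walk)
                                              (step (v~ (there w'∈)) v≢q₀' walk') (trans end (sym end')))

    -- An acyclic graph with at least one vertex has a vertex of degree < 2: extend a
    -- non-backtracking walk as long as its last vertex has degree ≥ 2; this stops within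
    -- n steps because the walk never repeats a vertex.
    leaf-exists : V → ∃[ r ] (¬ 2 ≤ degree G r)
    leaf-exists v = grow n v [] single (≤-reflexive (sym (+-identityʳ n)))
      where
      previous : V → List V → V
      previous u [] = u
      previous u (x ∷ _) = x

      away : ∀ {u w} xs → previous u xs ≢ w → NotFirst w xs
      away [] _ = tt
      away (x ∷ _) x≢w w≡x = x≢w (sym w≡x)

      grow : ∀ k u xs → NB (u ∷ xs) → n ≤ k + length xs → ∃[ r ] (¬ 2 ≤ degree G r)
      grow k u xs walk fuel with 2 ≤? degree G u
      ... | no small = u , small
      grow zero u xs walk fuel | yes _ = ⊥-elim (<⇒≱ (unique-length (nb-unique walk)) fuel)
      grow (suc k) u xs walk fuel | yes deg with kid-exists (previous u xs) u deg
      ... | w , w∈ with kids-mem w∈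
      ... | u~w , prev≢w =
        grow k w (u ∷ xs) (step (~-sym u~w) (away xs prev≢w) walk) (≤-trans fuel (≤-reflexive (sym (+-suc k (length xs)))))

    -- In a tree unfolded from a vertex r of degree < 2 beyond depth n, every depth layer
    -- dominates all vertices of degree ≥ 2: such a vertex u ≠ r is reached from r by a
    -- non-backtracking walk, which is short since it never repeats a vertex.
    layers-dominate : Connected G → ∀ r → ¬ 2 ≤ degree G r → ∀ f → n ≤ suc f → ∀ i u → 2 ≤ degree G u →
                      ∃[ x ] (x ∈ₗ layer i (unfold (suc f) r r) × (x ≡ u ⊎ u ~ x))
    layers-dominate connected r r-leaf f deep i u deg with shortcut (connected r u)
    ... | [] , _ , refl = ⊥-elim (r-leaf deg)
    ... | w ∷ q , walk@(step r~w _ _) , refl =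
      layer-dominates i f r r w q walk (~⇒≢ r~w) (s≤s⁻¹ (≤-trans (unique-length (nb-unique walk)) deep)) deg

lemma1 : (n : ℕ) (T : Graph n) → IsTree T →
         ∃[ D ] (∣ D ∣ ≤ ceil[n-2]/3 n ×
           (∀ (u : Fin n) → 2 ≤ degree T u → u ∉ D →
             ∃[ v ] (v ∈ D × Adj T u v)))
lemma1 zero T _ = ∅ , z≤n , λ ()
lemma1 n@(suc m) T (connected , acyclic) = entries D , small , dominated
  where
  open Unfolding T
  open Acyclic acyclic

  leaf : ∃[ r ] (¬ 2 ≤ degree T r)
  leaf = leaf-exists Fin.zero

  r : Fin n
  r = proj₁ leaf

  -- T rooted at the leaf r (taken as its own predecessor, which excludes no neighbour)
  R : Rose (Fin n)
  R = unfold n r r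

  thinnest : ∃[ i ] (3 * length (layer i R) ≤ size R)
  thinnest = thin-layer R

  D : List (Fin n)
  D = layer (proj₁ thinnest) R

  small : ∣ entries D ∣ ≤ ceil[n-2]/3 n
  small = ≤-trans (∣entries∣≤length D)
            (below-ceil (length D) n (≤-trans (proj₂ thinnest) (unique-length (unique-flat n r r))))

  dominated : ∀ u → 2 ≤ degree T u → u ∉ entries D → ∃[ v ] (v ∈ entries D × u ~ v)
  dominated u deg u∉D = neighbour (layers-dominate connected r (proj₂ leaf) m ≤-refl (proj₁ thinnest) u deg)
    where
    neighbour : ∃[ x ] (x ∈ₗ D × (x ≡ u ⊎ u ~ x)) → ∃[ v ] (v ∈ entries D × u ~ v)
    neighbour (x , x∈D , inj₁ refl) = ⊥-elim (u∉D (entries-mem x∈D))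
    neighbour (x , x∈D , inj₂ u~x) = x , entries-mem x∈D , u~x
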